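{- Let $n$ be a sufficiently large even integer. Let $K$ be an integer in $[\log^{10}n, n^{1/300}]$ and let $H$ be a graph on $n$ vertices such that: 1. $V(H)=U\cup W$ (a partition) with $|W|$ even; 2. $|W|=\frac{n}{K^2}\pm\left(\frac{n}{K^2}\right)^{2/3}$; 3. $\delta(H[W])\geq (1/2+\tau/2)|W|$ for some $\tau>100/K$; 4. Every vertex $u\in U$ has at least $\frac{n}{K^6}$ neighbours in $W$. Let $\mathcal{M}$ be a collection of $t\leq \frac{10n}{K^3}$ pairwise edge-disjoint matchings of $H[U]$ such that: (a) every matching in $\mathcal{M}$ covers at least $|U|-\frac{n}{K^{10}}$ vertices of $U$; (b) every vertex $u\in U$ is uncovered by at most $n/K^{10}$ matchings in $\mathcal{M}$. Then $\mathcal{M}$ can be extended to a collection of $t$ pairwise edge-disjoint perfect matchings of $H$ (i.e. there are pairwise edge-disjoint perfect matchings $\overline{M}\supseteq M$ of $H$, one for each $M\in\mathcal{M}$).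
   Context: $H[S]$ denotes the subgraph of $H$ induced on $S$ and $\delta(\cdot)$ denotes minimum degree. The notation $x=a\pm b$ means $a-b\leq x\leq a+b$. -}

module Defs where

open import Data.Bool using (Bool; true; false; _∧_; not; if_then_else_)
open import Data.Nat as ℕ using (ℕ; zero; suc)
open import Data.Fin using (Fin; zero; suc)
open import Data.Integer using (+_)
open import Data.Rational as ℚ using (ℚ; _/_; 0ℚ; 1ℚ)
open import Data.Product using (Σ; ∃; _×_; _,_)
open import Relation.Binary.PropositionalEquality using (_≡_)

count : ∀ {n} → (Fin n → Bool) → ℕ
count {zero}  P = 0
count {suc n} P = (if P zero then 1 else 0) ℕ.+ count {n} (λ i → P (suc i))

record Graph (n : ℕ) : Set where
  field
    adj   : Fin n → Fin n → Bool
    sym   : ∀ u v → adj u v ≡ adj v u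
    irref : ∀ v → adj v v ≡ false
open Graph public

VSet : ℕ → Set
VSet n = Fin n → Bool

∣_∣ : ∀ {n} → VSet n → ℕ
∣ S ∣ = count S

compl : ∀ {n} → VSet n → VSet n
compl S v = not (S v)

degIn : ∀ {n} → Graph n → VSet n → Fin n → ℕ
degIn H S v = count (λ w → S w ∧ adj H v w)

MinDegInducedGe : ∀ {n} → Graph n → VSet n → ℚ → Set
MinDegInducedGe H S d = ∀ v → S v ≡ true → d ℚ.≤ (+ degIn H S v / 1)

EdgeSet : ℕ → Set
EdgeSet n = Fin n → Fin n → Bool

degE : ∀ {n} → EdgeSet n → Fin n → ℕ
degE M v = count (M v)

IsMatchingIn : ∀ {n} → Graph n → VSet n → EdgeSet n → Set
IsMatchingIn H S M =
  (∀ u v → M u v ≡ M v u) ×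
  (∀ u v → M u v ≡ true → (adj H u v ≡ true) × (S u ≡ true) × (S v ≡ true)) ×
  (∀ v → degE M v ℕ.≤ 1)

IsPerfectMatching : ∀ {n} → Graph n → EdgeSet n → Set
IsPerfectMatching H M =
  (∀ u v → M u v ≡ M v u) ×
  (∀ u v → M u v ≡ true → adj H u v ≡ true) ×
  (∀ v → degE M v ≡ 1)

Covered : ∀ {n} → EdgeSet n → Fin n → Bool
Covered M v = if count (M v) ℕ.≡ᵇ 0 then false else true

EdgeDisjoint : ∀ {n} → EdgeSet n → EdgeSet n → Set
EdgeDisjoint M N = ∀ u v → M u v ≡ true → N u v ≡ false

_⊆E_ : ∀ {n} → EdgeSet n → EdgeSet n → Set
M ⊆E N = ∀ u v → M u v ≡ true → N u v ≡ true

-- Real-number side condition  (ln n)^10 ≤ K.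
-- (ln n)^10 ≤ K  ⇔  n ≤ e^(K^(1/10)).

powℚ : ℚ → ℕ → ℚ
powℚ y zero    = 1ℚ
powℚ y (suc k) = y ℚ.* powℚ y k

-- expTerm y k = y^k / k!
expTerm : ℚ → ℕ → ℚ
expTerm y zero    = 1ℚ
expTerm y (suc k) = expTerm y k ℚ.* (y ℚ.* (+ 1 / suc k))

expPartial : ℚ → ℕ → ℚ
expPartial y zero    = 1ℚ
expPartial y (suc N) = expPartial y N ℚ.+ expTerm y (suc N)

LogPow10Le : ℕ → ℕ → Set
LogPow10Le n K =
  Σ ℚ λ y → (0ℚ ℚ.≤ y) × (powℚ y 10 ℚ.≤ (+ K / 1)) ×
    ∃ λ N → (+ n / 1) ℚ.≤ expPartial y N

module Submission where

-- A partial matching is encoded as an involution q of the vertex set: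
-- v is paired with q v and unmatched iff q v ≡ v.  The matchings are
-- completed one at a time (ExtendAll), each by a round (ExtendOne) that
-- starts from M₀ and removes two fixed points per step:
--  * phase 1 matches every uncovered U-vertex to a free W-neighbour; this is
--    possible because U-vertices have many more W-neighbours than there are
--    uncovered vertices or earlier matchings in the way;
--  * phase 2 pairs the remaining fixed points, all in W, two at a time.  By
--    parity (n even) a second fixed point exists, and by the Dirac-type
--    minimum degree of H[W] two fixed points x, y are either adjacent or
--    have a common "switching" pair a, q a with xa, y(q a) usable.
-- Edges used by earlier completions are never reused, giving disjointness.

open import Defs hiding (sym)
open import Data.Bool using (Bool; true; false; not; _∧_; _∨_; if_then_else_)
open import Data.Bool.Properties using (∧-zeroʳ; ∧-identityʳ)
open import Data.Nat using (ℕ; zero; suc; _+_; _*_; _^_; _∸_; _≤_; _≥_; _<_; z≤n; s≤s; ∣_-_∣; _%_; NonZero; >-nonZero; _≤?_)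
open import Data.Nat.Properties
open import Data.Nat.DivMod using ([m+kn]%n≡m%n)
open import Data.Nat.Tactic.RingSolver using (solve-∀)
open import Data.Fin using (Fin; zero; suc)
import Data.Fin.Properties as FinP
open import Data.Product using (Σ; ∃; _×_; _,_; proj₁; proj₂)
open import Data.Sum using (_⊎_; inj₁; inj₂)
open import Data.Empty using (⊥; ⊥-elim)
open import Relation.Nullary using (yes; no; Dec)
open import Relation.Nullary.Decidable using (isYes)
open import Relation.Binary.PropositionalEquality

∧-intro : ∀ {a b} → a ≡ true → b ≡ true → (a ∧ b) ≡ true
∧-intro refl refl = refl

∧-fst : ∀ {a} b → (a ∧ b) ≡ true → a ≡ true
∧-fst {true} b e = refl

∧-snd : ∀ a {b} → (a ∧ b) ≡ true → b ≡ true
∧-snd true e = e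

∨-inl : ∀ {a} b → a ≡ true → (a ∨ b) ≡ true
∨-inl b refl = refl

∨-inr : ∀ a {b} → b ≡ true → (a ∨ b) ≡ true
∨-inr true e = refl
∨-inr false e = e

∨-cases : ∀ a {b} → (a ∨ b) ≡ true → a ≡ true ⊎ b ≡ true
∨-cases true e = inj₁ refl
∨-cases false e = inj₂ e

not-intro : ∀ {a} → a ≡ false → not a ≡ true
not-intro refl = refl

not-elim : ∀ {a} → not a ≡ true → a ≡ false
not-elim {false} e = refl

not-not : ∀ {b} → not (not b) ≡ true → b ≡ true
not-not {true} e = refl

true≢false : ∀ {a} → a ≡ true → a ≡ false → ⊥
true≢false refl ()

bool-cases : ∀ (a : Bool) → a ≡ true ⊎ a ≡ false
bool-cases true = inj₁ refl
bool-cases false = inj₂ refl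

_==_ : ∀ {n} → Fin n → Fin n → Bool
a == b = isYes (a FinP.≟ b)

==-refl : ∀ {n} (a : Fin n) → (a == a) ≡ true
==-refl a with a FinP.≟ a
... | yes _ = refl
... | no a≢a = ⊥-elim (a≢a refl)

==⇒≡ : ∀ {n} {a b : Fin n} → (a == b) ≡ true → a ≡ b
==⇒≡ {a = a} {b} e with a FinP.≟ b
... | yes a≡b = a≡b

≢⇒== : ∀ {n} {a b : Fin n} → a ≢ b → (a == b) ≡ false
≢⇒== {a = a} {b} a≢b with a FinP.≟ b
... | yes a≡b = ⊥-elim (a≢b a≡b)
... | no _ = refl

not==⇒≢ : ∀ {n} {a b : Fin n} → not (a == b) ≡ true → a ≢ b
not==⇒≢ {a = a} e refl = true≢false (==-refl a) (not-elim e)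

⟦_⟧ : Bool → ℕ
⟦ b ⟧ = if b then 1 else 0

count-cong : ∀ {n} {P Q : Fin n → Bool} → (∀ v → P v ≡ Q v) → count P ≡ count Q
count-cong {zero} e = refl
count-cong {suc n} {P} {Q} e rewrite e zero = cong (⟦ Q zero ⟧ +_) (count-cong (λ i → e (suc i)))

count-mono : ∀ {n} {P Q : Fin n → Bool} → (∀ v → P v ≡ true → Q v ≡ true) → count P ≤ count Q
count-mono {zero} e = z≤n
count-mono {suc n} {P} {Q} e with P zero in eq
... | true rewrite e zero eq = s≤s (count-mono (λ i → e (suc i)))
... | false = ≤-trans (count-mono (λ i → e (suc i))) (m≤n+m _ ⟦ Q zero ⟧)

count-none : ∀ {n} {P : Fin n → Bool} → (∀ v → P v ≡ false) → count P ≡ 0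
count-none {zero} e = refl
count-none {suc n} {P} e rewrite e zero = count-none (λ i → e (suc i))

count≡0⇒none : ∀ {n} {P : Fin n → Bool} → count P ≡ 0 → ∀ v → P v ≡ false
count≡0⇒none {suc n} {P} c v with P zero in eq
count≡0⇒none {suc n} {P} c zero | false = eq
count≡0⇒none {suc n} {P} c (suc v) | false = count≡0⇒none c v

none-or-witness : ∀ {n} (P : Fin n → Bool) → count P ≡ 0 ⊎ ∃ λ v → P v ≡ true
none-or-witness {zero} P = inj₁ refl
none-or-witness {suc n} P with P zero in eq
... | true = inj₂ (zero , eq)
... | false with none-or-witness (λ i → P (suc i))
...   | inj₁ none = inj₁ none
...   | inj₂ (v , pv) = inj₂ (suc v , pv)

witness : ∀ {n} (P : Fin n → Bool) → 0 < count P → ∃ λ v → P v ≡ true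
witness P pos with none-or-witness P
... | inj₁ none = ⊥-elim (<-irrefl (sym none) pos)
... | inj₂ w = w

count≤size : ∀ {n} (P : Fin n → Bool) → count P ≤ n
count≤size {zero} P = z≤n
count≤size {suc n} P with P zero
... | true = s≤s (count≤size _)
... | false = m≤n⇒m≤1+n (count≤size _)

count-tail≤ : ∀ {n} (P : Fin (suc n) → Bool) → count (λ i → P (suc i)) ≤ count P
count-tail≤ P = m≤n+m _ ⟦ P zero ⟧

count-∨∧ : ∀ {n} (P Q : Fin n → Bool) →
  count P + count Q ≡ count (λ v → P v ∨ Q v) + count (λ v → P v ∧ Q v)
count-∨∧ {zero} P Q = refl
count-∨∧ {suc n} P Q with P zero | Q zero | count-∨∧ (λ i → P (suc i)) (λ i → Q (suc i))
... | true  | true  | ih = cong suc (trans (+-suc _ _) (trans (cong suc ih) (sym (+-suc _ _))))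
... | true  | false | ih = cong suc ih
... | false | true  | ih = trans (+-suc _ _) (cong suc ih)
... | false | false | ih = ih

count-∨ : ∀ {n} (P Q : Fin n → Bool) → count (λ v → P v ∨ Q v) ≤ count P + count Q
count-∨ P Q = ≤-trans (m≤m+n _ _) (≤-reflexive (sym (count-∨∧ P Q)))

count-compl : ∀ {n} (P : Fin n → Bool) → count P + count (λ v → not (P v)) ≡ n
count-compl {zero} P = refl
count-compl {suc n} P with P zero
... | true = cong suc (count-compl _)
... | false = trans (+-suc _ _) (cong suc (count-compl _))

count-remove : ∀ {n} (P : Fin n → Bool) (a : Fin n) → P a ≡ true →
  count P ≡ suc (count (λ v → P v ∧ not (v == a)))
count-remove {suc n} P zero pa rewrite pa = cong suc (count-cong keep)
  where
  keep : ∀ i → P (suc i) ≡ (P (suc i) ∧ not (suc i == zero))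
  keep i rewrite ≢⇒== {a = suc i} {b = zero} (λ ()) = sym (∧-identityʳ _)
count-remove {suc n} P (suc a) pa =
  trans (cong (⟦ P zero ⟧ +_) (count-remove (λ i → P (suc i)) a pa))
        (trans (+-suc _ _) (cong suc (cong₂ _+_ head (count-cong tail))))
  where
  head : ⟦ P zero ⟧ ≡ ⟦ P zero ∧ not (zero == suc a) ⟧
  head rewrite ≢⇒== {a = zero} {b = suc a} (λ ()) = cong ⟦_⟧ (sym (∧-identityʳ _))
  tail : ∀ i → (P (suc i) ∧ not (i == a)) ≡ (P (suc i) ∧ not (suc i == suc a))
  tail i with i FinP.≟ a | suc i FinP.≟ suc a
  ... | yes _ | yes _ = refl
  ... | no _  | no _  = refl
  ... | yes i≡a | no si≢sa = ⊥-elim (si≢sa (cong suc i≡a))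
  ... | no i≢a  | yes si≡sa = ⊥-elim (i≢a (FinP.suc-injective si≡sa))

count-drop2 : ∀ {n} (P Q : Fin n → Bool) x y → x ≢ y → P x ≡ true → P y ≡ true →
  (∀ v → Q v ≡ true → (P v ≡ true) × (v ≢ x) × (v ≢ y)) → count Q + 2 ≤ count P
count-drop2 P Q x y x≢y px py Q⊆P = begin
    count Q + 2           ≤⟨ +-monoˡ-≤ 2 (count-mono Q⊆P₂) ⟩
    count P₂ + 2          ≡⟨ +-comm (count P₂) 2 ⟩
    suc (suc (count P₂))  ≡⟨ cong suc (sym (count-remove P₁ y p₁y)) ⟩
    suc (count P₁)        ≡⟨ sym (count-remove P x px) ⟩
    count P               ∎
  where
  open ≤-Reasoning
  P₁ = λ v → P v ∧ not (v == x)
  P₂ = λ v → P₁ v ∧ not (v == y)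
  p₁y : P₁ y ≡ true
  p₁y = ∧-intro py (not-intro (≢⇒== (λ y≡x → x≢y (sym y≡x))))
  Q⊆P₂ : ∀ v → Q v ≡ true → P₂ v ≡ true
  Q⊆P₂ v qv with Q⊆P v qv
  ... | pv , v≢x , v≢y = ∧-intro (∧-intro pv (not-intro (≢⇒== v≢x))) (not-intro (≢⇒== v≢y))

count≤1-unique : ∀ {n} (P : Fin n → Bool) → count P ≤ 1 →
  ∀ a b → P a ≡ true → P b ≡ true → a ≡ b
count≤1-unique P c a b pa pb with a FinP.≟ b
... | yes a≡b = a≡b
... | no a≢b = ⊥-elim (<-irrefl refl (≤-trans two≤count c))
  where
  two≤count : 2 ≤ count P
  two≤count = ≤-trans (m≤n+m 2 _) (count-drop2 P (λ _ → false) a b a≢b pa pb (λ _ ()))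

count-single : ∀ {n} (a : Fin n) → count (λ v → a == v) ≡ 1
count-single a = trans (count-remove _ a (==-refl a)) (cong suc (count-none only-a))
  where
  only-a : ∀ v → ((a == v) ∧ not (v == a)) ≡ false
  only-a v with a FinP.≟ v | v FinP.≟ a
  ... | no _ | _ = refl
  ... | yes _ | yes _ = refl
  ... | yes a≡v | no v≢a = ⊥-elim (v≢a (sym a≡v))

count-inj : ∀ {m n} (f : Fin m → Fin n) → (∀ i j → f i ≡ f j → i ≡ j) →
  (P : Fin n → Bool) → count (λ i → P (f i)) ≤ count P
count-inj {zero} f inj P = z≤n
count-inj {suc m} f inj P with P (f zero) in eq
... | false = count-inj (λ i → f (suc i)) inj-tail P
  where
  inj-tail : ∀ i j → f (suc i) ≡ f (suc j) → i ≡ j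
  inj-tail i j e = FinP.suc-injective (inj _ _ e)
... | true = begin
    suc (count (λ i → P (f (suc i))))   ≡⟨ cong suc (count-cong rest) ⟩
    suc (count (λ i → P′ (f (suc i))))  ≤⟨ s≤s (count-inj (λ i → f (suc i)) inj-tail P′) ⟩
    suc (count P′)                      ≡⟨ sym (count-remove P (f zero) eq) ⟩
    count P                             ∎
  where
  open ≤-Reasoning
  P′ = λ v → P v ∧ not (v == f zero)
  inj-tail : ∀ i j → f (suc i) ≡ f (suc j) → i ≡ j
  inj-tail i j e = FinP.suc-injective (inj _ _ e)
  rest : ∀ i → P (f (suc i)) ≡ P′ (f (suc i))
  rest i rewrite ≢⇒== {a = f (suc i)} {b = f zero} (λ e → FinP.0≢1+n (sym (inj _ _ e))) =
    sym (∧-identityʳ _)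

anyF : ∀ {t} → (Fin t → Bool) → Bool
anyF {zero} P = false
anyF {suc t} P = P zero ∨ anyF (λ j → P (suc j))

anyF-intro : ∀ {t} (P : Fin t → Bool) j → P j ≡ true → anyF P ≡ true
anyF-intro P zero e rewrite e = refl
anyF-intro P (suc j) e = ∨-inr (P zero) (anyF-intro _ j e)

anyF-elim : ∀ {t} (P : Fin t → Bool) → anyF P ≡ true → ∃ λ j → P j ≡ true
anyF-elim {suc t} P e with ∨-cases (P zero) e
... | inj₁ p0 = zero , p0
... | inj₂ rest with anyF-elim (λ j → P (suc j)) rest
...   | j , pj = suc j , pj

anyF-none : ∀ {t} (P : Fin t → Bool) → (∀ j → P j ≡ false) → anyF P ≡ false
anyF-none {zero} P e = refl
anyF-none {suc t} P e rewrite e zero = anyF-none _ (λ j → e (suc j))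

count-image : ∀ {t n} (R : Fin t → Bool) (f : Fin t → Fin n) →
  count (λ a → anyF (λ j → R j ∧ (f j == a))) ≤ count R
count-image {zero} {n} R f = ≤-reflexive (count-none {n} (λ v → refl))
count-image {suc t} {n} R f =
  ≤-trans (count-∨ (λ a → R zero ∧ (f zero == a)) (λ a → anyF (λ j → R (suc j) ∧ (f (suc j) == a))))
          (+-mono-≤ head (count-image (λ j → R (suc j)) (λ j → f (suc j))))
  where
  head : count (λ a → R zero ∧ (f zero == a)) ≤ ⟦ R zero ⟧
  head with R zero
  ... | true = ≤-reflexive (count-single (f zero))
  ... | false = ≤-reflexive (count-none {n} (λ v → refl))


Involution : ∀ {n} → (Fin n → Fin n) → Set
Involution q = ∀ v → q (q v) ≡ v

involution-injective : ∀ {n} (q : Fin n → Fin n) → Involution q → ∀ u v → q u ≡ q v → u ≡ v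
involution-injective q inv u v e = trans (sym (inv u)) (trans (cong q e) (inv v))

isFixed : ∀ {n} → (Fin n → Fin n) → Fin n → Bool
isFixed q v = q v == v

fixed⇒≡ : ∀ {n} {q : Fin n → Fin n} {v} → isFixed q v ≡ true → q v ≡ v
fixed⇒≡ = ==⇒≡

≡⇒fixed : ∀ {n} {q : Fin n → Fin n} {v} → q v ≡ v → isFixed q v ≡ true
≡⇒fixed {v = v} e rewrite e = ==-refl v

data Position {n} (v x a : Fin n) : Set where
  at-x  : v ≡ x → Position v x a
  at-a  : v ≡ a → Position v x a
  other : v ≢ x → v ≢ a → Position v x a

position : ∀ {n} (v x a : Fin n) → Position v x a
position v x a with v FinP.≟ x | v FinP.≟ a
... | yes v≡x | _ = at-x v≡x
... | no v≢x | yes v≡a = at-a v≡a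
... | no v≢x | no v≢a = other v≢x v≢a

link : ∀ {n} → (Fin n → Fin n) → Fin n → Fin n → Fin n → Fin n
link q x a v = if v == x then a else (if v == a then x else q v)

link-x : ∀ {n} (q : Fin n → Fin n) x a → link q x a x ≡ a
link-x q x a rewrite ==-refl x = refl

link-a : ∀ {n} (q : Fin n → Fin n) x a → x ≢ a → link q x a a ≡ x
link-a q x a x≢a rewrite ≢⇒== {a = a} {b = x} (λ a≡x → x≢a (sym a≡x)) | ==-refl a = refl

link-other : ∀ {n} (q : Fin n → Fin n) x a v → v ≢ x → v ≢ a → link q x a v ≡ q v
link-other q x a v v≢x v≢a rewrite ≢⇒== v≢x | ≢⇒== v≢a = refl

link-involution : ∀ {n} (q : Fin n → Fin n) x a → Involution q → q x ≡ x → q a ≡ a → x ≢ a →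
  Involution (link q x a)
link-involution q x a inv qx qa x≢a v with position v x a
... | at-x refl rewrite link-x q v a = link-a q v a x≢a
... | at-a refl rewrite link-a q x v x≢a = link-x q x v
... | other v≢x v≢a rewrite link-other q x a v v≢x v≢a =
  trans (link-other q x a (q v) (moved v≢x qx) (moved v≢a qa)) (inv v)
  where
  moved : ∀ {v y} → v ≢ y → q y ≡ y → q v ≢ y
  moved {v} v≢y qy qv≡y = v≢y (trans (sym (inv v)) (trans (cong q qv≡y) qy))

unlink : ∀ {n} → (Fin n → Fin n) → Fin n → Fin n → Fin n
unlink q a v = if v == a then a else (if v == q a then q a else q v)

unlink-a : ∀ {n} (q : Fin n → Fin n) a → unlink q a a ≡ a
unlink-a q a rewrite ==-refl a = refl

unlink-qa : ∀ {n} (q : Fin n → Fin n) a → unlink q a (q a) ≡ q a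
unlink-qa q a with q a FinP.≟ a
... | yes qa≡a = sym qa≡a
... | no qa≢a rewrite ==-refl (q a) = refl

unlink-other : ∀ {n} (q : Fin n → Fin n) a v → v ≢ a → v ≢ q a → unlink q a v ≡ q v
unlink-other q a v v≢a v≢qa rewrite ≢⇒== v≢a | ≢⇒== v≢qa = refl

unlink-involution : ∀ {n} (q : Fin n → Fin n) a → Involution q → Involution (unlink q a)
unlink-involution q a inv v with position v a (q a)
... | at-x refl rewrite unlink-a q v = unlink-a q v
... | at-a refl rewrite unlink-qa q a = unlink-qa q a
... | other v≢a v≢qa rewrite unlink-other q a v v≢a v≢qa =
  trans (unlink-other q a (q v) qv≢a qv≢qa) (inv v)
  where
  qv≢a : q v ≢ a
  qv≢a qv≡a = v≢qa (trans (sym (inv v)) (cong q qv≡a))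
  qv≢qa : q v ≢ q a
  qv≢qa e = v≢a (involution-injective q inv v a e)

-- Parity: an involution moves an even number of points, so on an even
-- number of vertices it cannot have exactly one fixed point.

isMoved : ∀ {n} → (Fin n → Fin n) → Fin n → Bool
isMoved q v = not (isFixed q v)

moved-after-unlink : ∀ {n} (q : Fin n → Fin n) x → q x ≢ x →
  ∀ v → isMoved (unlink q x) v ≡ ((isMoved q v ∧ not (v == x)) ∧ not (v == q x))
moved-after-unlink q x qx≢x v with position v x (q x)
... | at-x refl rewrite unlink-a q v | ==-refl v | ∧-zeroʳ (isMoved q v) = refl
... | at-a refl rewrite unlink-qa q x | ==-refl (q x) | ∧-zeroʳ (isMoved q (q x) ∧ not (q x == x)) = refl
... | other v≢x v≢qx rewrite unlink-other q x v v≢x v≢qx | ≢⇒== v≢x | ≢⇒== v≢qx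
                          | ∧-identityʳ (isMoved q v) = sym (∧-identityʳ _)

unlink-moved-count : ∀ {n} (q : Fin n → Fin n) → Involution q → ∀ x → isMoved q x ≡ true →
  count (isMoved q) ≡ suc (suc (count (isMoved (unlink q x))))
unlink-moved-count q inv x mx =
  trans (count-remove _ x mx) (cong suc (trans (count-remove _ (q x) mqx)
    (cong suc (sym (count-cong (moved-after-unlink q x qx≢x))))))
  where
  qx≢x : q x ≢ x
  qx≢x e = true≢false (≡⇒fixed {q = q} e) (not-elim mx)
  mqx : (isMoved q (q x) ∧ not (q x == x)) ≡ true
  mqx = ∧-intro (not-intro (≢⇒== (λ e → qx≢x (trans (sym e) (inv x))))) (not-intro (≢⇒== qx≢x))

moved-even : ∀ {n} f (q : Fin n → Fin n) → Involution q → count (isMoved q) ≤ f →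
  ∃ λ k → count (isMoved q) ≡ k * 2
moved-even f q inv c with none-or-witness (isMoved q)
... | inj₁ none = 0 , none
moved-even zero q inv c | inj₂ (x , mx) with subst (_≤ 0) (count-remove _ x mx) c
... | ()
moved-even (suc f) q inv c | inj₂ (x , mx)
  with moved-even f (unlink q x) (unlink-involution q x inv)
         (≤-pred (≤-trans (n≤1+n _) (subst (_≤ suc f) (unlink-moved-count q inv x mx) c)))
... | k , e = suc k , trans (unlink-moved-count q inv x mx) (cong (λ m → suc (suc m)) e)

one-fixed-point-impossible : ∀ {n} (q : Fin n → Fin n) → Involution q → n % 2 ≡ 0 →
  count (isFixed q) ≢ 1
one-fixed-point-impossible {n} q inv n-even one with moved-even _ q inv ≤-refl
... | k , e = 0≢1 (begin
    0                ≡⟨ sym n-even ⟩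
    n % 2            ≡⟨ cong (_% 2) (sym (count-compl (isFixed q))) ⟩
    (count (isFixed q) + count (isMoved q)) % 2  ≡⟨ cong (_% 2) (cong₂ _+_ one e) ⟩
    (1 + k * 2) % 2  ≡⟨ [m+kn]%n≡m%n 1 k 2 ⟩
    1                ∎)
  where
  open ≡-Reasoning
  0≢1 : 0 ≢ 1
  0≢1 ()

covered⇒partner : ∀ {n} (M : EdgeSet n) v → Covered M v ≡ true → ∃ λ p → M v p ≡ true
covered⇒partner M v c with none-or-witness (M v)
... | inj₂ w = w
... | inj₁ none rewrite none = ⊥-elim (true≢false c refl)

uncovered⇒no-partner : ∀ {n} (M : EdgeSet n) v → Covered M v ≡ false → ∀ p → M v p ≡ false
uncovered⇒no-partner M v c with count (M v) in eq
... | zero = count≡0⇒none eq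

partner⇒covered : ∀ {n} (M : EdgeSet n) v p → M v p ≡ true → Covered M v ≡ true
partner⇒covered M v p m with bool-cases (Covered M v)
... | inj₁ c = c
... | inj₂ c = ⊥-elim (true≢false m (uncovered⇒no-partner M v c p))

-- The degree hypotheses are used only through the following consequence:
-- two vertices of degree above |W|/2 + slack have many common options.
halves-overlap : ∀ w s dx dy a b → w + 2 * s ≤ 2 * dx → w + 2 * s ≤ 2 * dy →
  dx ≤ a + s → dy ≤ b + s → w ≤ a + b
halves-overlap w s dx dy a b hx hy dx≤ dy≤ =
  *-cancelˡ-≤ 2 (+-cancelʳ-≤ (4 * s) (2 * w) (2 * (a + b)) (begin
    2 * w + 4 * s                    ≡⟨ regroup w s ⟩
    (w + 2 * s) + (w + 2 * s)        ≤⟨ +-mono-≤ hx hy ⟩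
    2 * dx + 2 * dy                  ≤⟨ +-mono-≤ (*-monoʳ-≤ 2 dx≤) (*-monoʳ-≤ 2 dy≤) ⟩
    2 * (a + s) + 2 * (b + s)        ≡⟨ collect a b s ⟩
    2 * (a + b) + 4 * s              ∎))
  where
  open ≤-Reasoning
  regroup : ∀ w s → 2 * w + 4 * s ≡ (w + 2 * s) + (w + 2 * s)
  regroup = solve-∀
  collect : ∀ a b s → 2 * (a + s) + 2 * (b + s) ≡ 2 * (a + b) + 4 * s
  collect = solve-∀

record Completion {n} (H : Graph n) (W : VSet n) (M : EdgeSet n) (q : Fin n → Fin n) : Set where
  field
    involutive  : Involution q
    adjacent    : ∀ u → adj H u (q u) ≡ true
    contains    : ∀ u v → M u v ≡ true → q u ≡ v
    uncovered→W : ∀ u → compl W u ≡ true → Covered M u ≡ false → W (q u) ≡ true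

-- The
-- numerical hypotheses are the slack left by those matchings:
-- R bounds the M₀-uncovered vertices of U, every U-vertex has more
-- W-neighbours than R plus the number of earlier partners in W, and
-- every W-vertex has a Dirac-type surplus over |W|/2.
module ExtendOne {n : ℕ} (H : Graph n) (W : VSet n) (n-even : n % 2 ≡ 0)
  {t : ℕ} (qs : Fin t → Fin n → Fin n) (qs-involution : ∀ j → Involution (qs j))
  (M₀ : EdgeSet n) (M₀-matching : IsMatchingIn H (compl W) M₀)
  (M₀-fresh : ∀ j u v → M₀ u v ≡ true → qs j u ≢ v)
  (R : ℕ) (uncovered≤R : count (λ u → compl W u ∧ not (Covered M₀ u)) ≤ R)
  (U-slack : ∀ x → compl W x ≡ true → R + count (λ j → W (qs j x)) < degIn H W x)
  (W-slack : ∀ w → W w ≡ true → count W + 2 * (R + t) ≤ 2 * degIn H W w) where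

  U : VSet n
  U = compl W

  W⇒¬U : ∀ {v} → W v ≡ true → U v ≡ true → ⊥
  W⇒¬U w u rewrite w = true≢false u refl

  ¬W⇒U : ∀ {v} → W v ≡ false → U v ≡ true
  ¬W⇒U e rewrite e = refl

  U≢W : ∀ {u z} → U u ≡ true → W z ≡ true → u ≢ z
  U≢W uu wz refl = W⇒¬U wz uu

  M₀-sym : ∀ u v → M₀ u v ≡ M₀ v u
  M₀-sym = proj₁ M₀-matching

  M₀-edge : ∀ u v → M₀ u v ≡ true → (adj H u v ≡ true) × (U u ≡ true) × (U v ≡ true)
  M₀-edge = proj₁ (proj₂ M₀-matching)

  M₀-unique : ∀ {u v w} → M₀ u v ≡ true → M₀ u w ≡ true → v ≡ w
  M₀-unique {u} = count≤1-unique (M₀ u) (proj₂ (proj₂ M₀-matching) u) _ _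

  Allowed : Fin n → Fin n → Set
  Allowed u v = (adj H u v ≡ true) × (∀ j → qs j u ≢ v) × (U u ≡ true → U v ≡ true → M₀ u v ≡ true)

  allowed-sym : ∀ {u v} → Allowed u v → Allowed v u
  allowed-sym {u} {v} (a , fresh , inM₀) =
    trans (Graph.sym H v u) a ,
    (λ j e → fresh j (trans (sym (cong (qs j) e)) (qs-involution j v))) ,
    (λ uv uu → trans (M₀-sym v u) (inM₀ uu uv))

  record Invariant (q : Fin n → Fin n) : Set where
    field
      involution : Involution q
      allowed    : ∀ v → q v ≡ v ⊎ Allowed v (q v)
      extends    : ∀ u v → M₀ u v ≡ true → q u ≡ v
  open Invariant

  fixed⇒M₀-free : ∀ {q} → Invariant q → ∀ {x} → q x ≡ x → ∀ p → M₀ x p ≡ false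
  fixed⇒M₀-free iv {x} qx p with bool-cases (M₀ x p)
  ... | inj₂ f = f
  ... | inj₁ m = ⊥-elim (true≢false (proj₁ (M₀-edge x x loop)) (irref H x))
    where
    loop : M₀ x x ≡ true
    loop = subst (λ z → M₀ x z ≡ true) (trans (sym (extends iv x p m)) qx) m

  FixedShrink : (Fin n → Fin n) → (Fin n → Fin n) → Fin n → Fin n → Set
  FixedShrink q q′ x y = ∀ v → isFixed q′ v ≡ true → (isFixed q v ≡ true) × (v ≢ x) × (v ≢ y)

  Improvement : ((Fin n → Fin n) → Set) → (Fin n → Fin n) → Set
  Improvement P q = Σ (Fin n → Fin n) λ q′ →
    Invariant q′ × P q′ × (count (isFixed q′) + 2 ≤ count (isFixed q))

  shrink⇒fewer : ∀ q q′ x y → q x ≡ x → q y ≡ y → x ≢ y → FixedShrink q q′ x y →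
    count (isFixed q′) + 2 ≤ count (isFixed q)
  shrink⇒fewer q q′ x y qx qy x≢y =
    count-drop2 (isFixed q) (isFixed q′) x y x≢y (≡⇒fixed {q = q} qx) (≡⇒fixed {q = q} qy)

  link-preserves : ∀ q → Invariant q → ∀ x a → q x ≡ x → q a ≡ a → x ≢ a → Allowed x a →
    Invariant (link q x a) × FixedShrink q (link q x a) x a
  link-preserves q iv x a qx qa x≢a ok =
    record { involution = link-involution q x a (involution iv) qx qa x≢a
           ; allowed = allowed′ ; extends = extends′ } ,
    shrink
    where
    allowed′ : ∀ v → link q x a v ≡ v ⊎ Allowed v (link q x a v)
    allowed′ v with position v x a
    ... | at-x refl rewrite link-x q v a = inj₂ ok
    ... | at-a refl rewrite link-a q x v x≢a = inj₂ (allowed-sym ok)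
    ... | other v≢x v≢a rewrite link-other q x a v v≢x v≢a = allowed iv v
    extends′ : ∀ u v → M₀ u v ≡ true → link q x a u ≡ v
    extends′ u v m = trans (link-other q x a u (not-at qx) (not-at qa)) (extends iv u v m)
      where
      not-at : ∀ {y} → q y ≡ y → u ≢ y
      not-at qy refl = true≢false m (fixed⇒M₀-free iv qy v)
    shrink : FixedShrink q (link q x a) x a
    shrink v e with position v x a
    ... | at-x refl rewrite link-x q v a = ⊥-elim (x≢a (sym (==⇒≡ e)))
    ... | at-a refl rewrite link-a q x v x≢a = ⊥-elim (x≢a (==⇒≡ e))
    ... | other v≢x v≢a rewrite link-other q x a v v≢x v≢a = e , v≢x , v≢a

  M₀-partner : ∀ v → Σ (Fin n) λ p → (M₀ v p ≡ true) ⊎ ((p ≡ v) × (∀ w → M₀ v w ≡ false))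
  M₀-partner v with none-or-witness (M₀ v)
  ... | inj₂ (p , m) = p , inj₁ m
  ... | inj₁ none = v , inj₂ (refl , count≡0⇒none none)

  q₀ : Fin n → Fin n
  q₀ v = proj₁ (M₀-partner v)

  q₀-extends : ∀ u v → M₀ u v ≡ true → q₀ u ≡ v
  q₀-extends u v m with proj₂ (M₀-partner u)
  ... | inj₁ m′ = M₀-unique m′ m
  ... | inj₂ (_ , none) = ⊥-elim (true≢false m (none v))

  q₀-invariant : Invariant q₀
  q₀-invariant = record { involution = involutive ; allowed = allowed₀ ; extends = q₀-extends }
    where
    involutive : Involution q₀
    involutive v with proj₂ (M₀-partner v)
    ... | inj₁ m = q₀-extends (q₀ v) v (trans (M₀-sym _ _) m)
    ... | inj₂ (e , _) = trans (cong q₀ e) e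
    allowed₀ : ∀ v → q₀ v ≡ v ⊎ Allowed v (q₀ v)
    allowed₀ v with proj₂ (M₀-partner v)
    ... | inj₁ m = inj₂ (proj₁ (M₀-edge _ _ m) , (λ j → M₀-fresh j v (q₀ v) m) , (λ _ _ → m))
    ... | inj₂ (e , _) = inj₁ e

  NoWWPair : (Fin n → Fin n) → Set
  NoWWPair q = ∀ a → W a ≡ true → W (q a) ≡ true → q a ≡ a

  q₀-noWW : NoWWPair q₀
  q₀-noWW a wa _ with proj₂ (M₀-partner a)
  ... | inj₁ m = ⊥-elim (W⇒¬U wa (proj₁ (proj₂ (M₀-edge _ _ m))))
  ... | inj₂ (e , _) = e

  -- W-vertices paired into U are partners of M₀-uncovered U-vertices,
  -- so there are at most R of them.
  pairedIntoU : (Fin n → Fin n) → Fin n → Bool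
  pairedIntoU q w = W w ∧ U (q w)

  pairedIntoU≤R : ∀ q → Invariant q → count (pairedIntoU q) ≤ R
  pairedIntoU≤R q iv = ≤-trans (count-mono {Q = λ w → uncoveredU (q w)} into-uncovered)
                       (≤-trans (count-inj q (involution-injective q (involution iv)) uncoveredU) uncovered≤R)
    where
    uncoveredU : Fin n → Bool
    uncoveredU u = U u ∧ not (Covered M₀ u)
    into-uncovered : ∀ w → pairedIntoU q w ≡ true → uncoveredU (q w) ≡ true
    into-uncovered w e with bool-cases (Covered M₀ (q w))
    ... | inj₂ c = ∧-intro (∧-snd (W w) e) (not-intro c)
    ... | inj₁ c with covered⇒partner M₀ (q w) c
    ...   | p , m = ⊥-elim (W⇒¬U (∧-fst (U (q w)) e) (proj₂ (proj₂ (M₀-edge _ _ m′))))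
      where
      m′ : M₀ (q w) w ≡ true
      m′ = subst (λ z → M₀ (q w) z ≡ true) (sym (trans (sym (involution iv w)) (extends iv (q w) p m))) m

  unused : Fin n → Fin n → Bool
  unused u v = not (anyF (λ j → qs j u == v))

  unused⇒fresh : ∀ {u v} → unused u v ≡ true → ∀ j → qs j u ≢ v
  unused⇒fresh {u} e j refl = true≢false (anyF-intro (λ k → qs k u == qs j u) j (==-refl _)) (not-elim e)

  usable : Fin n → Fin n → Bool
  usable u v = adj H u v ∧ unused u v

  usable-sym : ∀ {u v} → usable u v ≡ true → usable v u ≡ true
  usable-sym {u} {v} e = ∧-intro (trans (Graph.sym H v u) (∧-fst (unused u v) e)) (not-intro unused-back)
    where
    unused-back : anyF (λ j → qs j v == u) ≡ false
    unused-back = anyF-none _ (λ j → ≢⇒== (λ q≡ →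
      unused⇒fresh (∧-snd (adj H u v) e) j (trans (sym (cong (qs j) q≡)) (qs-involution j v))))

  usable⇒allowed : ∀ {u v} → usable u v ≡ true → W u ≡ true → Allowed u v
  usable⇒allowed {u} {v} e w = ∧-fst (unused u v) e , unused⇒fresh (∧-snd (adj H u v) e) , (λ uu _ → ⊥-elim (W⇒¬U w uu))

  takenInW : Fin n → Fin n → Bool
  takenInW x a = anyF (λ j → W (qs j x) ∧ (qs j x == a))

  takenInW≤ : ∀ x → count (takenInW x) ≤ count (λ j → W (qs j x))
  takenInW≤ x = count-image (λ j → W (qs j x)) (λ j → qs j x)

  unused-or-taken : ∀ x a → W a ≡ true → unused x a ≡ true ⊎ takenInW x a ≡ true
  unused-or-taken x a wa with bool-cases (anyF (λ j → qs j x == a))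
  ... | inj₂ none = inj₁ (not-intro none)
  ... | inj₁ some with anyF-elim (λ j → qs j x == a) some
  ...   | j , e = inj₂ (anyF-intro (λ j → W (qs j x) ∧ (qs j x == a)) j
                          (∧-intro (subst (λ z → W z ≡ true) (sym (==⇒≡ e)) wa) e))

  count-∨₃ : ∀ (P Q S : Fin n → Bool) → count (λ v → P v ∨ (Q v ∨ S v)) ≤ count P + (count Q + count S)
  count-∨₃ P Q S = ≤-trans (count-∨ P (λ v → Q v ∨ S v)) (+-monoʳ-≤ (count P) (count-∨ Q S))

  -- Phase 1.  A fixed U-vertex x has a fixed W-neighbour a with xa usable:
  -- its other W-neighbours are paired into U or taken by earlier matchings,
  -- and U-slack says these cannot exhaust deg_W(x).
  free-W-neighbour : ∀ q → Invariant q → NoWWPair q → ∀ x → U x ≡ true →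
    ∃ λ a → ((W a ∧ isFixed q a) ∧ usable x a) ≡ true
  free-W-neighbour q iv noWW x ux = witness good (≤-trans (s≤s z≤n) good-large)
    where
    good : Fin n → Bool
    good a = (W a ∧ isFixed q a) ∧ usable x a
    classify : ∀ a → (W a ∧ adj H x a) ≡ true → (good a ∨ (pairedIntoU q a ∨ takenInW x a)) ≡ true
    classify a e with bool-cases (isFixed q a)
    ... | inj₂ moved = ∨-inr (good a) (∨-inl (takenInW x a) (∧-intro wa (¬W⇒U wqa)))
      where
      wa = ∧-fst (adj H x a) e
      wqa : W (q a) ≡ false
      wqa with bool-cases (W (q a))
      ... | inj₁ w = ⊥-elim (true≢false (≡⇒fixed {q = q} (noWW a wa w)) moved)
      ... | inj₂ w = w
    ... | inj₁ fixed with unused-or-taken x a (∧-fst (adj H x a) e)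
    ...   | inj₁ fresh = ∨-inl (pairedIntoU q a ∨ takenInW x a)
                           (∧-intro (∧-intro (∧-fst (adj H x a) e) fixed) (∧-intro (∧-snd (W a) e) fresh))
    ...   | inj₂ taken = ∨-inr (good a) (∨-inr (pairedIntoU q a) taken)
    deg≤ : degIn H W x ≤ count good + (R + count (λ j → W (qs j x)))
    deg≤ = ≤-trans (count-mono classify) (≤-trans (count-∨₃ good (pairedIntoU q) (takenInW x))
             (+-monoʳ-≤ (count good) (+-mono-≤ (pairedIntoU≤R q iv) (takenInW≤ x))))
    good-large : 1 ≤ count good
    good-large with count good | deg≤
    ... | zero  | d = ⊥-elim (<-irrefl refl (<-≤-trans (U-slack x ux) d))
    ... | suc _ | _ = s≤s z≤n

  cover-U-vertex : ∀ q → Invariant q → NoWWPair q → ∀ x → U x ≡ true → q x ≡ x →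
    Improvement NoWWPair q
  cover-U-vertex q iv noWW x ux qx with free-W-neighbour q iv noWW x ux
  ... | a , ga = link q x a , proj₁ linked , noWW′ , shrink⇒fewer q _ x a qx qa x≢a (proj₂ linked)
    where
    wa : W a ≡ true
    wa = ∧-fst (isFixed q a) (∧-fst (usable x a) ga)
    qa : q a ≡ a
    qa = fixed⇒≡ {q = q} (∧-snd (W a) (∧-fst (usable x a) ga))
    x≢a : x ≢ a
    x≢a = U≢W ux wa
    ok : Allowed x a
    ok = ∧-fst (unused x a) xa , unused⇒fresh (∧-snd (adj H x a) xa) , (λ _ ua → ⊥-elim (W⇒¬U wa ua))
      where xa = ∧-snd (W a ∧ isFixed q a) ga
    linked = link-preserves q iv x a qx qa x≢a ok
    noWW′ : NoWWPair (link q x a)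
    noWW′ b wb wqb with position b x a
    ... | at-x refl = ⊥-elim (W⇒¬U wb ux)
    ... | at-a refl rewrite link-a q x b x≢a = ⊥-elim (W⇒¬U wqb ux)
    ... | other b≢x b≢a rewrite link-other q x a b b≢x b≢a = noWW b wb wqb

  NoFixedInU : (Fin n → Fin n) → Set
  NoFixedInU q = ∀ u → U u ≡ true → q u ≢ u

  fixed⇒W : ∀ q → NoFixedInU q → ∀ z → q z ≡ z → W z ≡ true
  fixed⇒W q noFix z qz with bool-cases (W z)
  ... | inj₁ w = w
  ... | inj₂ w = ⊥-elim (noFix z (¬W⇒U w) qz)

  link-noFixedInU : ∀ q → NoFixedInU q → ∀ x a → W x ≡ true → W a ≡ true → NoFixedInU (link q x a)
  link-noFixedInU q noFix x a wx wa u uu e = noFix u uu (trans (sym (link-other q x a u (U≢W uu wx) (U≢W uu wa))) e)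

  unlink-noFixedInU : ∀ q → NoFixedInU q → ∀ a → W a ≡ true → W (q a) ≡ true → NoFixedInU (unlink q a)
  unlink-noFixedInU q noFix a wa wb u uu e = noFix u uu (trans (sym (unlink-other q a u (U≢W uu wa) (U≢W uu wb))) e)

  unlink-preserves : ∀ q → Invariant q → ∀ a → W a ≡ true → W (q a) ≡ true → Invariant (unlink q a)
  unlink-preserves q iv a wa wb =
    record { involution = unlink-involution q a (involution iv) ; allowed = allowed′ ; extends = extends′ }
    where
    allowed′ : ∀ v → unlink q a v ≡ v ⊎ Allowed v (unlink q a v)
    allowed′ v with position v a (q a)
    ... | at-x refl = inj₁ (unlink-a q v)
    ... | at-a refl = inj₁ (unlink-qa q a)
    ... | other v≢a v≢b rewrite unlink-other q a v v≢a v≢b = allowed iv v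
    extends′ : ∀ u v → M₀ u v ≡ true → unlink q a u ≡ v
    extends′ u v m = trans (unlink-other q a u (U≢W uu wa) (U≢W uu wb)) (extends iv u v m)
      where uu = proj₁ (proj₂ (M₀-edge u v m))

  link-W : ∀ q → Invariant q → NoFixedInU q → ∀ x a → q x ≡ x → q a ≡ a → x ≢ a →
    W x ≡ true → W a ≡ true → usable x a ≡ true → Improvement NoFixedInU q
  link-W q iv noFix x a qx qa x≢a wx wa xa =
    link q x a , proj₁ linked , link-noFixedInU q noFix x a wx wa ,
    shrink⇒fewer q _ x a qx qa x≢a (proj₂ linked)
    where linked = link-preserves q iv x a qx qa x≢a (usable⇒allowed xa wx)

  pairedInW : (Fin n → Fin n) → Fin n → Bool
  pairedInW q a = W a ∧ not (U (q a))

  -- Each W-neighbour of z is paired into U, taken, or a usable pairedInW-vertex.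
  W-degree≤ : ∀ q → Invariant q → ∀ z →
    degIn H W z ≤ count (λ a → pairedInW q a ∧ usable z a) + (R + t)
  W-degree≤ q iv z = ≤-trans (count-mono classify) (≤-trans (count-∨₃ good (pairedIntoU q) (takenInW z))
    (+-monoʳ-≤ (count good) (+-mono-≤ (pairedIntoU≤R q iv) (≤-trans (takenInW≤ z) (count≤size _)))))
    where
    good : Fin n → Bool
    good a = pairedInW q a ∧ usable z a
    classify : ∀ a → (W a ∧ adj H z a) ≡ true → (good a ∨ (pairedIntoU q a ∨ takenInW z a)) ≡ true
    classify a e with bool-cases (U (q a))
    ... | inj₁ uqa = ∨-inr (good a) (∨-inl (takenInW z a) (∧-intro (∧-fst (adj H z a) e) uqa))
    ... | inj₂ ¬uqa with unused-or-taken z a (∧-fst (adj H z a) e)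
    ...   | inj₁ fresh = ∨-inl (pairedIntoU q a ∨ takenInW z a)
                           (∧-intro (∧-intro (∧-fst (adj H z a) e) (not-intro ¬uqa)) (∧-intro (∧-snd (W a) e) fresh))
    ...   | inj₂ taken = ∨-inr (good a) (∨-inr (pairedIntoU q a) taken)

  -- b ↦ q b maps the pairedInW-vertices usable from y injectively to those
  -- whose partner is usable from y.
  shift-partner : ∀ q → Invariant q → ∀ y →
    count (λ a → pairedInW q a ∧ usable y a) ≤ count (λ a → pairedInW q a ∧ usable y (q a))
  shift-partner q iv y = ≤-trans (count-mono into) (count-inj q (involution-injective q (involution iv)) _)
    where
    into : ∀ b → (pairedInW q b ∧ usable y b) ≡ true → (pairedInW q (q b) ∧ usable y (q (q b))) ≡ true
    into b e = ∧-intro (∧-intro (not-not (∧-snd (W b) p)) (subst (λ z → not (U z) ≡ true) (sym (involution iv b))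
                 (cong (λ v → not (not v)) (∧-fst (not (U (q b))) p))))
               (subst (λ z → usable y z ≡ true) (sym (involution iv b)) (∧-snd (pairedInW q b) e))
      where p = ∧-fst (usable y b) e

  -- If x, y are fixed and xy is not usable, then some
  -- a ∈ W, with q a ∈ W, has xa and y(q a) usable: both candidate sets are
  -- large by W-slack, and they live in W ∖ {x, y}.
  common-partner : ∀ q → Invariant q → NoFixedInU q → ∀ x y → q x ≡ x → q y ≡ y → x ≢ y →
    usable x y ≡ false →
    ∃ λ a → (W a ≡ true) × (W (q a) ≡ true) × (a ≢ x) × (a ≢ y) ×
            (usable x a ≡ true) × (usable y (q a) ≡ true)
  common-partner q iv noFix x y qx qy x≢y ¬xy =
    a , proj₁ a-inside , not-not (∧-snd (W a) (∧-fst (usable x a) nx)) ,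
    proj₁ (proj₂ a-inside) , proj₂ (proj₂ a-inside) , ∧-snd (pairedInW q a) nx , ∧-snd (pairedInW q a) ny
    where
    wx = fixed⇒W q noFix x qx
    wy = fixed⇒W q noFix y qy
    Nx Ny : Fin n → Bool
    Nx a = pairedInW q a ∧ usable x a
    Ny a = pairedInW q a ∧ usable y (q a)
    W≤ : count W ≤ count Nx + count Ny
    W≤ = ≤-trans (halves-overlap (count W) (R + t) _ _ (count Nx) _
                   (W-slack x wx) (W-slack y wy) (W-degree≤ q iv x) (W-degree≤ q iv y))
                 (+-monoʳ-≤ (count Nx) (shift-partner q iv y))
    inside : ∀ a → (Nx a ∨ Ny a) ≡ true → (W a ≡ true) × (a ≢ x) × (a ≢ y)
    inside a e with ∨-cases (Nx a) e
    ... | inj₁ nx = ∧-fst (not (U (q a))) (∧-fst (usable x a) nx) , a≢x , a≢y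
      where
      xa = ∧-snd (pairedInW q a) nx
      a≢x : a ≢ x
      a≢x refl = true≢false (∧-fst (unused a a) xa) (irref H a)
      a≢y : a ≢ y
      a≢y refl = true≢false xa ¬xy
    ... | inj₂ ny = ∧-fst (not (U (q a))) (∧-fst (usable y (q a)) ny) , a≢x , a≢y
      where
      yqa = ∧-snd (pairedInW q a) ny
      a≢x : a ≢ x
      a≢x refl = true≢false (usable-sym (subst (λ z → usable y z ≡ true) qx yqa)) ¬xy
      a≢y : a ≢ y
      a≢y refl = true≢false (∧-fst (unused a a) (subst (λ z → usable a z ≡ true) qy yqa)) (irref H a)
    two≤ : 2 ≤ count (λ a → Nx a ∧ Ny a)
    two≤ = +-cancelˡ-≤ (count (λ a → Nx a ∨ Ny a)) 2 _
             (≤-trans (count-drop2 W (λ a → Nx a ∨ Ny a) x y x≢y wx wy inside)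
               (≤-trans W≤ (≤-reflexive (count-∨∧ Nx Ny))))
    found = witness (λ a → Nx a ∧ Ny a) (≤-trans (s≤s z≤n) two≤)
    a = proj₁ found
    nx = ∧-fst (Ny a) (proj₂ found)
    ny = ∧-snd (Nx a) (proj₂ found)
    a-inside = inside a (∨-inl (Ny a) nx)

  -- If a ∈ W is paired with b = q a ∈ W, replace the pair ab by xa and yb.
  rotate : ∀ q → Invariant q → NoFixedInU q → ∀ x y a → q x ≡ x → q y ≡ y → x ≢ y →
    a ≢ x → a ≢ y → q a ≢ a → W a ≡ true → W (q a) ≡ true →
    usable x a ≡ true → usable y (q a) ≡ true → Improvement NoFixedInU q
  rotate q iv noFix x y a qx qy x≢y a≢x a≢y qa≢a wa wb xa yb =
    q₃ , proj₁ linked₃ , noFix₃ , shrink⇒fewer q q₃ x y qx qy x≢y shrink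
    where
    wx = fixed⇒W q noFix x qx
    wy = fixed⇒W q noFix y qy
    b = q a
    b≢x : b ≢ x
    b≢x e = a≢x (trans (sym (involution iv a)) (trans (cong q e) qx))
    b≢y : b ≢ y
    b≢y e = a≢y (trans (sym (involution iv a)) (trans (cong q e) qy))
    q₁ = unlink q a
    q₁x : q₁ x ≡ x
    q₁x = trans (unlink-other q a x (λ e → a≢x (sym e)) (λ e → b≢x (sym e))) qx
    q₁y : q₁ y ≡ y
    q₁y = trans (unlink-other q a y (λ e → a≢y (sym e)) (λ e → b≢y (sym e))) qy
    q₂ = link q₁ x a
    linked₂ = link-preserves q₁ (unlink-preserves q iv a wa wb) x a q₁x (unlink-a q a)
                (λ e → a≢x (sym e)) (usable⇒allowed xa wx)
    q₂y : q₂ y ≡ y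
    q₂y = trans (link-other q₁ x a y (λ e → x≢y (sym e)) (λ e → a≢y (sym e))) q₁y
    q₂b : q₂ b ≡ b
    q₂b = trans (link-other q₁ x a b b≢x qa≢a) (unlink-qa q a)
    q₃ = link q₂ y b
    linked₃ = link-preserves q₂ (proj₁ linked₂) y b q₂y q₂b (λ e → b≢y (sym e)) (usable⇒allowed yb wy)
    noFix₃ : NoFixedInU q₃
    noFix₃ = link-noFixedInU q₂ (link-noFixedInU q₁ (unlink-noFixedInU q noFix a wa wb) x a wx wa) y b wy wb
    shrink : FixedShrink q q₃ x y
    shrink v e with proj₂ linked₃ v e
    ... | f₂ , v≢y , v≢b with proj₂ linked₂ v f₂
    ...   | f₁ , v≢x , v≢a = subst (λ z → (z == v) ≡ true) (unlink-other q a v v≢a v≢b) f₁ , v≢x , v≢y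

  pair-fixed-pair : ∀ q → Invariant q → NoFixedInU q → ∀ x y → q x ≡ x → q y ≡ y → x ≢ y →
    Improvement NoFixedInU q
  pair-fixed-pair q iv noFix x y qx qy x≢y = by-edge (bool-cases (usable x y))
    where
    wx = fixed⇒W q noFix x qx
    wy = fixed⇒W q noFix y qy
    via : ∀ a → W a ≡ true → W (q a) ≡ true → a ≢ x → a ≢ y → usable x a ≡ true → usable y (q a) ≡ true →
      Dec (q a ≡ a) → Improvement NoFixedInU q
    via a wa wqa a≢x a≢y xa yqa (yes qa≡a) = link-W q iv noFix x a qx qa≡a (λ e → a≢x (sym e)) wx wa xa
    via a wa wqa a≢x a≢y xa yqa (no qa≢a) = rotate q iv noFix x y a qx qy x≢y a≢x a≢y qa≢a wa wqa xa yqa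
    by-edge : usable x y ≡ true ⊎ usable x y ≡ false → Improvement NoFixedInU q
    by-edge (inj₁ xy) = link-W q iv noFix x y qx qy x≢y wx wy xy
    by-edge (inj₂ ¬xy) = via-partner (common-partner q iv noFix x y qx qy x≢y ¬xy)
      where
      via-partner : (∃ λ a → (W a ≡ true) × (W (q a) ≡ true) × (a ≢ x) × (a ≢ y) ×
                      (usable x a ≡ true) × (usable y (q a) ≡ true)) → Improvement NoFixedInU q
      via-partner (a , wa , wqa , a≢x , a≢y , xa , yqa) = via a wa wqa a≢x a≢y xa yqa (q a FinP.≟ a)

  -- Both phases iterate their step; the number of fixed points bounds the
  -- number of iterations.
  fewer-fuel : ∀ {a b f} → a + 2 ≤ b → b ≤ suc f → a ≤ f
  fewer-fuel {a} {b} {f} h₁ h₂ = ≤-trans (n≤1+n a) (≤-pred (subst (_≤ suc f) (+-comm a 2) (≤-trans h₁ h₂)))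

  cover-all-U : ∀ f q → Invariant q → NoWWPair q → count (isFixed q) ≤ f →
    Σ (Fin n → Fin n) λ q′ → Invariant q′ × NoFixedInU q′
  cover-all-U f q iv noWW c with none-or-witness (λ v → U v ∧ isFixed q v)
  ... | inj₁ none = q , iv , (λ u uu qu → true≢false (∧-intro uu (≡⇒fixed {q = q} qu)) (count≡0⇒none none u))
  cover-all-U zero q iv noWW c | inj₂ (x , ex) with subst (_≤ 0) (count-remove _ x (∧-snd (U x) ex)) c
  ... | ()
  cover-all-U (suc f) q iv noWW c | inj₂ (x , ex)
    with cover-U-vertex q iv noWW x (∧-fst (isFixed q x) ex) (fixed⇒≡ {q = q} (∧-snd (U x) ex))
  ... | q′ , iv′ , noWW′ , fewer = cover-all-U f q′ iv′ noWW′ (fewer-fuel fewer c)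

  -- A second fixed point always exists by parity.
  pair-all-W : ∀ f q → Invariant q → NoFixedInU q → count (isFixed q) ≤ f →
    Σ (Fin n → Fin n) λ q′ → Invariant q′ × (∀ v → q′ v ≢ v)
  pair-all-W f q iv noFix c with none-or-witness (isFixed q)
  ... | inj₁ none = q , iv , (λ v qv → true≢false (≡⇒fixed {q = q} qv) (count≡0⇒none none v))
  pair-all-W zero q iv noFix c | inj₂ (x , fx) with subst (_≤ 0) (count-remove _ x fx) c
  ... | ()
  pair-all-W (suc f) q iv noFix c | inj₂ (x , fx) with none-or-witness (λ v → isFixed q v ∧ not (v == x))
  ... | inj₁ none = ⊥-elim (one-fixed-point-impossible q (involution iv) n-even
                      (trans (count-remove _ x fx) (cong suc none)))
  ... | inj₂ (y , fy)
    with pair-fixed-pair q iv noFix x y (fixed⇒≡ {q = q} fx) (fixed⇒≡ {q = q} (∧-fst _ fy))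
           (λ x≡y → not==⇒≢ (∧-snd (isFixed q y) fy) (sym x≡y))
  ... | q′ , iv′ , noFix′ , fewer = pair-all-W f q′ iv′ noFix′ (fewer-fuel fewer c)

  completion : Σ (Fin n → Fin n) λ q → Completion H W M₀ q × (∀ j u → q u ≢ qs j u)
  completion = q ,
    record { involutive = involution iv ; adjacent = λ u → proj₁ (allowed′ u)
           ; contains = extends iv ; uncovered→W = toW } ,
    (λ j u e → proj₁ (proj₂ (allowed′ u)) j (sym e))
    where
    phase₁ = cover-all-U n q₀ q₀-invariant q₀-noWW (count≤size _)
    phase₂ = pair-all-W n (proj₁ phase₁) (proj₁ (proj₂ phase₁)) (proj₂ (proj₂ phase₁)) (count≤size _)
    q = proj₁ phase₂
    iv = proj₁ (proj₂ phase₂)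
    allowed′ : ∀ u → Allowed u (q u)
    allowed′ u with allowed iv u
    ... | inj₁ fixed = ⊥-elim (proj₂ (proj₂ phase₂) u fixed)
    ... | inj₂ ok = ok
    toW : ∀ u → U u ≡ true → Covered M₀ u ≡ false → W (q u) ≡ true
    toW u uu c with bool-cases (W (q u))
    ... | inj₁ w = w
    ... | inj₂ w = ⊥-elim (true≢false (partner⇒covered M₀ u (q u) (proj₂ (proj₂ (allowed′ u)) uu (¬W⇒U w))) c)


into-W⇒uncovered : ∀ {n} {H : Graph n} {W M q} → IsMatchingIn H (compl W) M → Completion H W M q →
  ∀ u → W (q u) ≡ true → not (Covered M u) ≡ true
into-W⇒uncovered {W = W} {M} isM c u w with bool-cases (Covered M u)
... | inj₂ unc = not-intro unc
... | inj₁ cov with covered⇒partner M u cov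
...   | p , m = ⊥-elim (true≢false (subst (λ z → W z ≡ true) (Completion.contains c u p m) w)
                                   (not-elim (proj₂ (proj₂ (proj₁ (proj₂ isM) u p m)))))

-- A completion of M does not use the edges of a matching M′ of H[U] that
-- is edge-disjoint from M: at a vertex covered by M it follows M, and at
-- an uncovered U-vertex it goes into W.
completion-avoids : ∀ {n} {H : Graph n} {W M M′ q} → IsMatchingIn H (compl W) M′ →
  Completion H W M q → EdgeDisjoint M′ M → ∀ u v → M′ u v ≡ true → q u ≢ v
completion-avoids {W = W} {M} isM′ c disj u v m′ qu≡v with bool-cases (Covered M u)
... | inj₂ unc = true≢false (subst (λ z → W z ≡ true) qu≡v (Completion.uncovered→W c u (proj₁ in-U) unc))
                            (not-elim (proj₂ in-U))
  where in-U = proj₂ (proj₁ (proj₂ isM′) u v m′)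
... | inj₁ cov with covered⇒partner M u cov
...   | p , m = true≢false (subst (λ z → M u z ≡ true) (trans (sym (Completion.contains c u p m)) qu≡v) m)
                           (disj u v m′)

-- L is the scale of the "few uncovered vertices" hypotheses
-- (K¹⁰ in the application); U-bound and W-bound are the slack conditions
-- of one round in terms of the numbers r, s of vertices/matchings at stake.
module ExtendAll {n : ℕ} (H : Graph n) (W : VSet n) (n-even : n % 2 ≡ 0) (L T : ℕ)
  (U-bound : ∀ r s x → r * L ≤ n → s * L ≤ n → compl W x ≡ true → r + s < degIn H W x)
  (W-bound : ∀ r s w → r * L ≤ n → s ≤ T → W w ≡ true → count W + 2 * (r + s) ≤ 2 * degIn H W w) where

  Completions : ∀ t → (Fin t → EdgeSet n) → Set
  Completions t M = Σ (Fin t → Fin n → Fin n) λ qs →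
    (∀ i → Completion H W (M i) (qs i)) × (∀ i j → i ≢ j → ∀ u → qs i u ≢ qs j u)

  extend-all : ∀ t → t ≤ T → (M : Fin t → EdgeSet n) →
    (∀ i → IsMatchingIn H (compl W) (M i)) →
    (∀ i j → i ≢ j → EdgeDisjoint (M i) (M j)) →
    (∀ i → count (λ u → compl W u ∧ not (Covered (M i) u)) * L ≤ n) →
    (∀ u → compl W u ≡ true → count (λ i → not (Covered (M i) u)) * L ≤ n) →
    Completions t M
  extend-all zero _ M _ _ _ _ = (λ ()) , (λ ()) , (λ ())
  extend-all (suc t) t<T M isM disj fewU fewMissed = qs′ , complete , distinct
    where
    rest = extend-all t (≤-trans (n≤1+n t) t<T) (λ i → M (suc i)) (λ i → isM (suc i))
             (λ i j i≢j → disj (suc i) (suc j) (λ e → i≢j (FinP.suc-injective e))) (λ i → fewU (suc i))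
             (λ u uu → ≤-trans (*-monoˡ-≤ L (count-tail≤ (λ i → not (Covered (M i) u)))) (fewMissed u uu))
    qs = proj₁ rest
    done : ∀ j → Completion H W (M (suc j)) (qs j)
    done = proj₁ (proj₂ rest)
    R = count (λ u → compl W u ∧ not (Covered (M zero) u))
    U-slack : ∀ x → compl W x ≡ true → R + count (λ j → W (qs j x)) < degIn H W x
    U-slack x ux = U-bound R _ x (fewU zero)
      (≤-trans (*-monoˡ-≤ L (≤-trans (count-mono (λ j → into-W⇒uncovered (isM (suc j)) (done j) x))
                                     (count-tail≤ (λ i → not (Covered (M i) x))))) (fewMissed x ux)) ux
    W-slack : ∀ w → W w ≡ true → count W + 2 * (R + t) ≤ 2 * degIn H W w
    W-slack w ww = W-bound R t w (fewU zero) (≤-trans (n≤1+n t) t<T) ww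
    round = ExtendOne.completion H W n-even qs (λ j → Completion.involutive (done j))
              (M zero) (isM zero) (λ j → completion-avoids (isM zero) (done j) (disj zero (suc j) (λ ())))
              R ≤-refl U-slack W-slack
    qs′ : Fin (suc t) → Fin n → Fin n
    qs′ zero = proj₁ round
    qs′ (suc j) = qs j
    complete : ∀ i → Completion H W (M i) (qs′ i)
    complete zero = proj₁ (proj₂ round)
    complete (suc j) = done j
    distinct : ∀ i j → i ≢ j → ∀ u → qs′ i u ≢ qs′ j u
    distinct zero zero i≢j = ⊥-elim (i≢j refl)
    distinct zero (suc j) _ u = proj₂ (proj₂ round) j u
    distinct (suc i) zero _ u e = proj₂ (proj₂ round) i u (sym e)
    distinct (suc i) (suc j) i≢j = proj₂ (proj₂ rest) i j (λ e → i≢j (cong suc e))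

open import Data.Integer as ℤ using (+_)
import Data.Integer.Properties as ℤP
open import Data.Rational as ℚ using (ℚ; _/_; ½)
import Data.Rational.Properties as ℚP
import Data.Rational.Unnormalised as ℚᵘ
import Data.Rational.Unnormalised.Properties as ℚᵘP
open import Data.Rational.Solver using (module +-*-Solver)
import Data.Nat.Coprimality as Coprime

-- ι a is the rational a in normal form; + a / 1 reduces to it only
-- propositionally.
ι : ℕ → ℚ
ι a = ℚ.mkℚ (+ a) 0 (Coprime.sym (Coprime.1-coprimeTo a))

/1≡ι : ∀ a → + a / 1 ≡ ι a
/1≡ι a = ℚP.normalize-coprime (Coprime.sym (Coprime.1-coprimeTo a))

ι-+ : ∀ a b → ι (a + b) ≡ ι a ℚ.+ ι b
ι-+ a b = ℚP.toℚᵘ-injective (ℚᵘP.≃-trans (ℚᵘ.*≡* (cong (ℤ._* + 1) sum)) (ℚᵘP.≃-sym (ℚP.toℚᵘ-homo-+ (ι a) (ι b))))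
  where
  sum : + (a + b) ≡ + a ℤ.* + 1 ℤ.+ + b ℤ.* + 1
  sum = trans (ℤP.pos-+ a b) (sym (cong₂ ℤ._+_ (ℤP.*-identityʳ (+ a)) (ℤP.*-identityʳ (+ b))))

ι-* : ∀ a b → ι (a * b) ≡ ι a ℚ.* ι b
ι-* a b = ℚP.toℚᵘ-injective (ℚᵘP.≃-trans (ℚᵘ.*≡* (cong (ℤ._* + 1) (ℤP.pos-* a b)))
                                          (ℚᵘP.≃-sym (ℚP.toℚᵘ-homo-* (ι a) (ι b))))

ι-≤-reflect : ∀ {a b} → ι a ℚ.≤ ι b → a ≤ b
ι-≤-reflect {a} {b} h = ℤP.drop‿+≤+ (subst₂ ℤ._≤_ (ℤP.*-identityʳ (+ a)) (ℤP.*-identityʳ (+ b)) (ℚP.drop-*≤* h))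

min-degree⇒bound : ∀ (τ : ℚ) (K w d : ℕ) → (+ 100 / 1) ℚ.< τ ℚ.* (+ K / 1) →
  (½ ℚ.+ τ ℚ.* ½) ℚ.* (+ w / 1) ℚ.≤ (+ d / 1) → (K + 100) * w ≤ 2 * K * d
min-degree⇒bound τ K w d τK>100 δ≥ rewrite /1≡ι 100 | /1≡ι K | /1≡ι w | /1≡ι d = ι-≤-reflect (begin
    ι ((K + 100) * w)                        ≡⟨ trans (ι-* (K + 100) w) (cong (ℚ._* ι w) (ι-+ K 100)) ⟩
    (ι K ℚ.+ ι 100) ℚ.* ι w                  ≡⟨ ℚP.*-distribʳ-+ (ι w) (ι K) (ι 100) ⟩
    ι K ℚ.* ι w ℚ.+ ι 100 ℚ.* ι w            ≤⟨ ℚP.+-monoʳ-≤ (ι K ℚ.* ι w) (ℚP.*-monoʳ-≤-nonNeg (ι w) (ℚP.<⇒≤ τK>100)) ⟩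
    ι K ℚ.* ι w ℚ.+ (τ ℚ.* ι K) ℚ.* ι w      ≡⟨ double-half (ι K) (ι w) τ ⟩
    (ι 2 ℚ.* ι K) ℚ.* ((½ ℚ.+ τ ℚ.* ½) ℚ.* ι w) ≤⟨ ℚP.*-monoˡ-≤-nonNeg (ι 2 ℚ.* ι K) {{2K≥0}} δ≥ ⟩
    (ι 2 ℚ.* ι K) ℚ.* ι d                    ≡⟨ sym (trans (ι-* (2 * K) d) (cong (ℚ._* ι d) (ι-* 2 K))) ⟩
    ι (2 * K * d)                            ∎)
  where
  open ℚP.≤-Reasoning
  open +-*-Solver
  2K≥0 : ℚ.NonNegative (ι 2 ℚ.* ι K)
  2K≥0 = subst ℚ.NonNegative (ι-* 2 K) _
  -- uses only 2 · ½ = 1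
  double-half : ∀ k w τ → k ℚ.* w ℚ.+ (τ ℚ.* k) ℚ.* w ≡ (ι 2 ℚ.* k) ℚ.* ((½ ℚ.+ τ ℚ.* ½) ℚ.* w)
  double-half k w τ = trans (sym (ℚP.*-identityʳ _))
    (solve 5 (λ k w τ h t → (k :* w :+ (τ :* k) :* w) :* (t :* h) := (t :* k) :* ((h :+ τ :* h) :* w))
           refl k w τ ½ (ι 2))

K²·8≤K³⁰⁰ : ∀ K → 2 ≤ K → K ^ 2 * 8 ≤ K ^ 300
K²·8≤K³⁰⁰ K K≥2 = begin
    K ^ 2 * 8      ≤⟨ *-monoʳ-≤ (K ^ 2) (≤-trans (^-monoʳ-≤ 2 {3} {298} (s≤s (s≤s (s≤s z≤n)))) (^-monoˡ-≤ 298 K≥2)) ⟩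
    K ^ 2 * K ^ 298 ≡⟨ sym (^-distribˡ-+-* K 2 298) ⟩
    K ^ 300        ∎
  where open ≤-Reasoning

≥2⇒nonZero : ∀ {K} → 2 ≤ K → NonZero K
≥2⇒nonZero {suc K} _ = _

n≤K²-impossible : ∀ K n → K ^ 300 ≤ n → n ≤ K ^ 2 → 2 ≤ n → ⊥
n≤K²-impossible K n K³⁰⁰≤n n≤K² n≥2 with 2 ≤? K
... | yes K≥2 = <-irrefl refl (≤-trans (≤-trans K²<8K² (K²·8≤K³⁰⁰ K K≥2)) (≤-trans K³⁰⁰≤n n≤K²))
  where
  K²<8K² : K ^ 2 < K ^ 2 * 8
  K²<8K² = subst (_< K ^ 2 * 8) (*-identityʳ (K ^ 2))
             (*-monoʳ-< (K ^ 2) {{m^n≢0 K 2 {{≥2⇒nonZero K≥2}}}} (s≤s (s≤s z≤n)))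
... | no K≱2 with ≤-trans n≥2 (≤-trans n≤K² (^-monoˡ-≤ 2 (≤-pred (≰⇒> K≱2))))
...   | s≤s ()

-- |W| K² ≥ n/2: otherwise ||W|K² − n| > n/2, and the cube of the error
-- bound forces n < 8K².
n≤2·wK² : ∀ K n a → 2 ≤ K → K ^ 300 ≤ n → ∣ a - n ∣ ^ 3 ≤ n ^ 2 * K ^ 2 → n ≤ 2 * a
n≤2·wK² K n a K≥2 K³⁰⁰≤n err with n ≤? 2 * a
... | yes n≤2a = n≤2a
... | no n≰2a = ⊥-elim (<-irrefl refl (≤-trans (*-cancelʳ-< _ n (8 * K ^ 2) n³<8K²n²)
                                                (≤-trans (≤-reflexive (*-comm 8 (K ^ 2))) (≤-trans (K²·8≤K³⁰⁰ K K≥2) K³⁰⁰≤n))))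
  where
  2a<n : 2 * a < n
  2a<n = ≰⇒> n≰2a
  a≤n : a ≤ n
  a≤n = ≤-trans (m≤m+n a (a + 0)) (<⇒≤ 2a<n)
  D = n ∸ a
  D+a≡n : D + a ≡ n
  D+a≡n = m∸n+n≡m a≤n
  a<D : a < D
  a<D = +-cancelʳ-< a a D (subst₂ _<_ (cong (λ m → a + m) (+-identityʳ a)) (sym D+a≡n) 2a<n)
  n<2D : n < 2 * D
  n<2D = subst₂ _<_ D+a≡n (cong (λ m → D + m) (sym (+-identityʳ D))) (+-monoʳ-< D a<D)
  D³≤n²K² : D ^ 3 ≤ n ^ 2 * K ^ 2
  D³≤n²K² = subst (λ m → m ^ 3 ≤ n ^ 2 * K ^ 2) (m≤n⇒∣m-n∣≡n∸m a≤n) err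
  n³<8K²n² : n * n ^ 2 < (8 * K ^ 2) * n ^ 2
  n³<8K²n² = begin-strict
    n ^ 3               <⟨ ^-monoˡ-< 3 n<2D ⟩
    (2 * D) ^ 3         ≡⟨ cube-double D ⟩
    8 * D ^ 3           ≤⟨ *-monoʳ-≤ 8 D³≤n²K² ⟩
    8 * (n ^ 2 * K ^ 2) ≡⟨ reorder n K ⟩
    (8 * K ^ 2) * n ^ 2 ∎
    where
    open ≤-Reasoning
    -- powers are unfolded so that the ring solver sees plain products
    cube-double : ∀ D → (2 * D) * ((2 * D) * ((2 * D) * 1)) ≡ 8 * (D * (D * (D * 1)))
    cube-double = solve-∀
    reorder : ∀ n K → 8 * ((n * (n * 1)) * (K * (K * 1))) ≡ (8 * (K * (K * 1))) * (n * (n * 1))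
    reorder = solve-∀

K≥100 : ∀ K w d → 1 ≤ w → d ≤ w → (K + 100) * w ≤ 2 * K * d → 100 ≤ K
K≥100 K w@(suc _) d _ d≤w δ = *-cancelʳ-≤ 100 K w (+-cancelˡ-≤ (K * w) (100 * w) (K * w) (begin
    K * w + 100 * w ≡⟨ sym (*-distribʳ-+ w K 100) ⟩
    (K + 100) * w   ≤⟨ δ ⟩
    2 * K * d       ≤⟨ *-monoʳ-≤ (2 * K) d≤w ⟩
    2 * K * w       ≡⟨ double K w ⟩
    K * w + K * w   ∎))
  where
  open ≤-Reasoning
  double : ∀ K w → 2 * K * w ≡ K * w + K * w
  double = solve-∀

-- Slack at U-vertices: each has ≥ n/K⁶ W-neighbours, far more than the
-- 2n/K¹⁰ vertices/matchings that can be in the way.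
U-degree-slack : ∀ K n d r s → 2 ≤ K → 1 ≤ n → n ≤ d * K ^ 6 →
  r * K ^ 10 ≤ n → s * K ^ 10 ≤ n → r + s < d
U-degree-slack K n d r s K≥2 n≥1 n≤dK⁶ rK¹⁰≤n sK¹⁰≤n = *-cancelʳ-< (K ^ 10) (r + s) d (begin-strict
    (r + s) * K ^ 10        ≡⟨ *-distribʳ-+ (K ^ 10) r s ⟩
    r * K ^ 10 + s * K ^ 10 ≤⟨ +-mono-≤ rK¹⁰≤n sK¹⁰≤n ⟩
    n + n                   <⟨ 2n<16n ⟩
    n * 16                  ≤⟨ *-monoʳ-≤ n (^-monoˡ-≤ 4 K≥2) ⟩
    n * K ^ 4               ≤⟨ *-monoˡ-≤ (K ^ 4) n≤dK⁶ ⟩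
    d * K ^ 6 * K ^ 4       ≡⟨ trans (*-assoc d (K ^ 6) (K ^ 4)) (cong (d *_) (sym (^-distribˡ-+-* K 6 4))) ⟩
    d * K ^ 10              ∎)
  where
  open ≤-Reasoning
  2n<16n : n + n < n * 16
  2n<16n = subst (_< n * 16) (trans (*-comm n 2) (cong (λ m → n + m) (+-identityʳ n)))
             (*-monoʳ-< n {{>-nonZero n≥1}} {2} {16} (s≤s (s≤s (s≤s z≤n))))

-- Slack at W-vertices: the r uncovered vertices and s ≤ t earlier
-- matchings cost at most 100|W|/K ≤ τ|W|, which the minimum degree absorbs.
W-degree-slack : ∀ K n w d r s t → 2 ≤ K → n ≤ 2 * (w * K ^ 2) → (K + 100) * w ≤ 2 * K * d →
  r * K ^ 10 ≤ n → s ≤ t → t * K ^ 3 ≤ 10 * n → w + 2 * (r + s) ≤ 2 * d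
W-degree-slack K n w d r s t K≥2 n≤2wK² δ rK¹⁰≤n s≤t tK³≤10n = *-cancelˡ-≤ K {{K≢0}} (begin
    K * (w + 2 * (r + s))     ≡⟨ *-distribˡ-+ K w (2 * (r + s)) ⟩
    K * w + K * (2 * (r + s)) ≤⟨ +-monoʳ-≤ (K * w) cost≤100w ⟩
    K * w + 100 * w           ≡⟨ sym (*-distribʳ-+ w K 100) ⟩
    (K + 100) * w             ≤⟨ δ ⟩
    2 * K * d                 ≡⟨ *-assoc 2 K d ⟩
    2 * (K * d)               ≡⟨ cong (2 *_) (*-comm K d) ⟩
    2 * (d * K)               ≡⟨ sym (*-assoc 2 d K) ⟩
    2 * d * K                 ≡⟨ *-comm (2 * d) K ⟩
    K * (2 * d)               ∎)
  where
  open ≤-Reasoning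
  K≢0 : NonZero K
  K≢0 = ≥2⇒nonZero K≥2
  rK³≤n : r * K ^ 3 ≤ n
  rK³≤n = ≤-trans (*-monoʳ-≤ r (^-monoʳ-≤ K {{K≢0}} {3} {10} (s≤s (s≤s (s≤s z≤n))))) rK¹⁰≤n
  sK³≤10n : s * K ^ 3 ≤ 10 * n
  sK³≤10n = ≤-trans (*-monoˡ-≤ (K ^ 3) s≤t) tK³≤10n
  cost≤100w : K * (2 * (r + s)) ≤ 100 * w
  cost≤100w = *-cancelʳ-≤ _ _ (K ^ 2) {{m^n≢0 K 2 {{K≢0}}}} (begin
    K * (2 * (r + s)) * K ^ 2           ≡⟨ spread K r s ⟩
    2 * (r * K ^ 3) + 2 * (s * K ^ 3)   ≤⟨ +-mono-≤ (*-monoʳ-≤ 2 rK³≤n) (*-monoʳ-≤ 2 sK³≤10n) ⟩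
    2 * n + 2 * (10 * n)                ≡⟨ collect n ⟩
    22 * n                              ≤⟨ *-monoʳ-≤ 22 n≤2wK² ⟩
    22 * (2 * (w * K ^ 2))              ≡⟨ gather w K ⟩
    44 * w * K ^ 2                      ≤⟨ *-monoˡ-≤ (K ^ 2) (*-monoˡ-≤ w {44} {100} (m≤m+n 44 56)) ⟩
    100 * w * K ^ 2                     ∎)
    where
    spread : ∀ K r s → K * (2 * (r + s)) * (K * (K * 1)) ≡ 2 * (r * (K * (K * (K * 1)))) + 2 * (s * (K * (K * (K * 1))))
    spread = solve-∀
    collect : ∀ n → 2 * n + 2 * (10 * n) ≡ 22 * n
    collect = solve-∀
    gather : ∀ w K → 22 * (2 * (w * (K * (K * 1)))) ≡ 44 * w * (K * (K * 1))
    gather = solve-∀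


pairsOf : ∀ {n} → (Fin n → Fin n) → EdgeSet n
pairsOf q u v = q u == v

pairsOf-sym : ∀ {n} (q : Fin n → Fin n) → Involution q → ∀ u v → pairsOf q u v ≡ pairsOf q v u
pairsOf-sym q inv u v with q u FinP.≟ v | q v FinP.≟ u
... | yes _ | yes _ = refl
... | no _  | no _  = refl
... | yes qu≡v | no qv≢u = ⊥-elim (qv≢u (trans (cong q (sym qu≡v)) (inv u)))
... | no qu≢v  | yes qv≡u = ⊥-elim (qu≢v (trans (cong q (sym qv≡u)) (inv v)))

completion⇒perfect : ∀ {n} {H : Graph n} {W M q} → Completion H W M q → IsPerfectMatching H (pairsOf q)
completion⇒perfect {H = H} {q = q} c =
  pairsOf-sym q (Completion.involutive c) ,
  (λ u v e → subst (λ z → adj H u z ≡ true) (==⇒≡ e) (Completion.adjacent c u)) ,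
  (λ v → count-single (q v))

completion⇒contains : ∀ {n} {H : Graph n} {W M q} → Completion H W M q → M ⊆E pairsOf q
completion⇒contains {q = q} c u v m = subst (λ z → (q u == z) ≡ true) (Completion.contains c u v m) (==-refl (q u))

disjoint-pairs : ∀ {n} (q q′ : Fin n → Fin n) → (∀ u → q u ≢ q′ u) → EdgeDisjoint (pairsOf q) (pairsOf q′)
disjoint-pairs q q′ differ u v e = ≢⇒== (λ q′u≡v → differ u (trans (==⇒≡ e) (sym q′u≡v)))

extend-matchings : ∀ {n} (H : Graph n) (W : VSet n) → n % 2 ≡ 0 → (L T : ℕ) →
  (∀ r s x → r * L ≤ n → s * L ≤ n → compl W x ≡ true → r + s < degIn H W x) →
  (∀ r s w → r * L ≤ n → s ≤ T → W w ≡ true → count W + 2 * (r + s) ≤ 2 * degIn H W w) →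
  ∀ t → t ≤ T → (M : Fin t → EdgeSet n) →
  (∀ i → IsMatchingIn H (compl W) (M i)) →
  (∀ i j → i ≢ j → EdgeDisjoint (M i) (M j)) →
  (∀ i → count (λ u → compl W u ∧ not (Covered (M i) u)) * L ≤ n) →
  (∀ u → compl W u ≡ true → count (λ i → not (Covered (M i) u)) * L ≤ n) →
  Σ (Fin t → EdgeSet n) λ M̄ →
    (∀ i → IsPerfectMatching H (M̄ i)) × (∀ i → M i ⊆E M̄ i) × (∀ i j → i ≢ j → EdgeDisjoint (M̄ i) (M̄ j))
extend-matchings H W n-even L T U-bound W-bound t t≤T M isM disj fewU fewMissed
  with ExtendAll.extend-all H W n-even L T U-bound W-bound t t≤T M isM disj fewU fewMissed
... | qs , complete , distinct =
  (λ i → pairsOf (qs i)) , (λ i → completion⇒perfect (complete i)) ,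
  (λ i → completion⇒contains (complete i)) , (λ i j i≢j → disjoint-pairs (qs i) (qs j) (distinct i j i≢j))

few-uncovered : ∀ {n} L m (S C : Fin n → Bool) → (∀ v → C v ≡ true → S v ≡ true) →
  count S * L ≤ count C * L + m → count (λ v → S v ∧ not (C v)) * L ≤ m
few-uncovered L m S C C⊆S covers = +-cancelʳ-≤ (count C * L) _ m (begin
    count Sᶜ * L + count C * L   ≡⟨ sym (*-distribʳ-+ L (count Sᶜ) (count C)) ⟩
    (count Sᶜ + count C) * L     ≤⟨ *-monoˡ-≤ L split ⟩
    count S * L                  ≤⟨ covers ⟩
    count C * L + m              ≡⟨ +-comm (count C * L) m ⟩
    m + count C * L              ∎)
  where
  open ≤-Reasoning
  Sᶜ = λ v → S v ∧ not (C v)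
  disjoint : ∀ v → (Sᶜ v ∧ C v) ≡ false
  disjoint v with C v
  ... | true = trans (∧-identityʳ _) (∧-zeroʳ (S v))
  ... | false = ∧-zeroʳ _
  within : ∀ v → (Sᶜ v ∨ C v) ≡ true → S v ≡ true
  within v e with ∨-cases (Sᶜ v) e
  ... | inj₁ s = ∧-fst (not (C v)) s
  ... | inj₂ c = C⊆S v c
  split : count Sᶜ + count C ≤ count S
  split = begin
    count Sᶜ + count C                                           ≡⟨ count-∨∧ Sᶜ C ⟩
    count (λ v → Sᶜ v ∨ C v) + count (λ v → Sᶜ v ∧ C v)          ≡⟨ cong (λ k → count (λ v → Sᶜ v ∨ C v) + k) (count-none disjoint) ⟩
    count (λ v → Sᶜ v ∨ C v) + 0                                 ≡⟨ +-identityʳ _ ⟩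
    count (λ v → Sᶜ v ∨ C v)                                     ≤⟨ count-mono within ⟩
    count S                                                      ∎

covered⊆U : ∀ {n} {H : Graph n} {U M} → IsMatchingIn H U M → ∀ v → Covered M v ≡ true → U v ≡ true
covered⊆U {M = M} (_ , edges , _) v c with covered⇒partner M v c
... | p , m = proj₁ (proj₂ (edges v p m))

-- K ≥ 2: W is non-empty (else n³ ≤ n²K², contradicting K³⁰⁰ ≤ n), and the
-- minimum degree at any of its vertices gives K ≥ 100.
K≥2 : ∀ {n} K (H : Graph n) (W : VSet n) → 2 ≤ n → K ^ 300 ≤ n →
  ∣ ∣ W ∣ * K ^ 2 - n ∣ ^ 3 ≤ n ^ 2 * K ^ 2 →
  (∀ v → W v ≡ true → (K + 100) * ∣ W ∣ ≤ 2 * K * degIn H W v) → 2 ≤ K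
K≥2 {n} K H W n≥2 K³⁰⁰≤n err δ with none-or-witness W
... | inj₁ empty = ⊥-elim (n≤K²-impossible K n K³⁰⁰≤n n≤K² n≥2)
  where
  n³≤n²K² : n * n ^ 2 ≤ K ^ 2 * n ^ 2
  n³≤n²K² = subst₂ _≤_ (cong (λ w → ∣ w * K ^ 2 - n ∣ ^ 3) empty) (*-comm (n ^ 2) (K ^ 2)) err
  n≤K² : n ≤ K ^ 2
  n≤K² = *-cancelʳ-≤ n (K ^ 2) (n ^ 2) {{m^n≢0 n 2 {{>-nonZero (≤-trans (s≤s z≤n) n≥2)}}}} n³≤n²K²
... | inj₂ (v , wv) = ≤-trans (m≤m+n 2 98) (K≥100 K ∣ W ∣ (degIn H W v) W≥1 deg≤ (δ v wv))
  where
  W≥1 : 1 ≤ ∣ W ∣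
  W≥1 = ≤-trans (s≤s z≤n) (≤-reflexive (sym (count-remove W v wv)))
  deg≤ : degIn H W v ≤ ∣ W ∣
  deg≤ = count-mono (λ a e → ∧-fst (adj H v a) e)

lemma2p13 :
    ∃ λ n₀ → ∀ (n : ℕ) → n ≥ n₀ → n % 2 ≡ 0 →
    ∀ (K : ℕ) → LogPow10Le n K → K ^ 300 ≤ n →
    ∀ (H : Graph n) (W : VSet n) →
    let U = compl W in
    ∣ W ∣ % 2 ≡ 0 →
    ∣ ∣ W ∣ * K ^ 2 - n ∣ ^ 3 ≤ n ^ 2 * K ^ 2 →
    (Σ ℚ λ τ → ((+ 100 / 1) ℚ.< τ ℚ.* (+ K / 1)) ×
      MinDegInducedGe H W ((½ ℚ.+ τ ℚ.* ½) ℚ.* (+ ∣ W ∣ / 1))) →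
    (∀ u → U u ≡ true → n ≤ degIn H W u * K ^ 6) →
    ∀ (t : ℕ) → t * K ^ 3 ≤ 10 * n →
    ∀ (M : Fin t → EdgeSet n) →
    (∀ i → IsMatchingIn H U (M i)) →
    (∀ i j → i ≢ j → EdgeDisjoint (M i) (M j)) →
    (∀ i → ∣ U ∣ * K ^ 10 ≤ count (Covered (M i)) * K ^ 10 + n) →
    (∀ u → U u ≡ true →
      count (λ i → not (Covered (M i) u)) * K ^ 10 ≤ n) →
    Σ (Fin t → EdgeSet n) λ M̄ →
      (∀ i → IsPerfectMatching H (M̄ i)) ×
      (∀ i → M i ⊆E M̄ i) ×
      (∀ i j → i ≢ j → EdgeDisjoint (M̄ i) (M̄ j))
lemma2p13 = 2 , λ n n≥2 n-even K _ K³⁰⁰≤n H W _ err (τ , τK>100 , δ) degU t tK³≤10n M isM disj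
                  almostPerfect rarelyMissed →
  let δ′ : ∀ v → W v ≡ true → (K + 100) * ∣ W ∣ ≤ 2 * K * degIn H W v
      δ′ v wv = min-degree⇒bound τ K ∣ W ∣ (degIn H W v) τK>100 (δ v wv)
      K≥2′ = K≥2 K H W n≥2 K³⁰⁰≤n err δ′
      n≤2wK² = n≤2·wK² K n (∣ W ∣ * K ^ 2) K≥2′ K³⁰⁰≤n err
  in extend-matchings H W n-even (K ^ 10) t
       (λ r s x rK¹⁰≤n sK¹⁰≤n ux → U-degree-slack K n _ r s K≥2′ (≤-trans (s≤s z≤n) n≥2) (degU x ux) rK¹⁰≤n sK¹⁰≤n)
       (λ r s v rK¹⁰≤n s≤t wv → W-degree-slack K n ∣ W ∣ _ r s t K≥2′ n≤2wK² (δ′ v wv) rK¹⁰≤n s≤t tK³≤10n)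
       t ≤-refl M isM disj
       (λ i → few-uncovered (K ^ 10) n (compl W) (Covered (M i)) (covered⊆U {H = H} (isM i)) (almostPerfect i))
       rarelyMissed
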